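{- Let $m\ge 3$ and let $A_m$ be an $F_m$-matrix. Then $A_m$ is not an extreme point of $\mathbf{U}_m$.
   Context: $I_m=\{1,\dots,m\}$. $\mathbf{U}_m$ is the set of real $m\times m$ matrices $A_m=(a_{ij})$ with $a_{ij}=a_{ji}\ge 0$ for all $i,j$ and $\sum_{i,j\in\alpha}a_{ij}\le|\alpha|$ for every $\alpha\subset I_m$ ($|\alpha|$ the cardinality). $\mathbf{U}_m^{(0,\frac12,1)}=\{A_m\in\mathbf{U}_m: a_{ii}\in\{0,1\},\ a_{ij}\in\{0,\frac12,1\}\ \forall i,j\}$. A nonempty $\alpha\subset I_m$ is saturated for $A_m$ if $\sum_{i,j\in\alpha}a_{ij}=|\alpha|$. An $F_m$-matrix is a matrix $A_m\in\mathbf{U}_m^{(0,\frac12,1)}$ such that $I_m$ is saturated and no nonempty proper subset $\alpha\subsetneq I_m$ is saturated.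
   Formalization: The matrices in $\mathbf{U}_m$ have entries in ℚ rather than real entries, and convex combinations are taken with rational coefficients. -}

module Defs where

open import Data.Nat using (ℕ; zero; suc)
open import Data.Fin using (Fin; zero; suc)
open import Data.Fin.Subset using (Subset; _∈_; _∉_; ⊤; ∣_∣; Nonempty)
open import Data.Fin.Subset.Properties using (_∈?_)
open import Data.Rational using (ℚ; 0ℚ; 1ℚ; ½; _+_; _*_; _-_; _≤_; _<_)
import Data.Rational as ℚ
import Data.Integer as ℤ
open import Data.Product using (_×_; Σ)
open import Data.Sum using (_⊎_)
open import Relation.Nullary using (¬_; yes; no)
open import Relation.Binary.PropositionalEquality using (_≡_; _≢_)

-- Real symmetric-type matrices are modelled with rational entries.
Matrix : ℕ → Set
Matrix m = Fin m → Fin m → ℚ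

ΣFin : (n : ℕ) → (Fin n → ℚ) → ℚ
ΣFin zero    f = 0ℚ
ΣFin (suc n) f = f zero + ΣFin n (λ i → f (suc i))

card : ∀ {m} → Subset m → ℚ
card α = (ℤ.+ ∣ α ∣) ℚ./ 1

restrict : ∀ {m} → Subset m → Matrix m → Fin m → Fin m → ℚ
restrict α A i j with i ∈? α | j ∈? α
... | yes _ | yes _ = A i j
... | _     | _     = 0ℚ

blockSum : ∀ {m} → Matrix m → Subset m → ℚ
blockSum {m} A α = ΣFin m (λ i → ΣFin m (λ j → restrict α A i j))

InU : (m : ℕ) → Matrix m → Set
InU m A =
  (∀ i j → A i j ≡ A j i) ×
  (∀ i j → 0ℚ ≤ A i j) ×
  (∀ (α : Subset m) → blockSum A α ≤ card α)

InU012 : (m : ℕ) → Matrix m → Set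
InU012 m A =
  InU m A ×
  (∀ i → (A i i ≡ 0ℚ) ⊎ (A i i ≡ 1ℚ)) ×
  (∀ i j → (A i j ≡ 0ℚ) ⊎ ((A i j ≡ ½) ⊎ (A i j ≡ 1ℚ)))

Saturated : ∀ {m} → Matrix m → Subset m → Set
Saturated A α = Nonempty α × (blockSum A α ≡ card α)

IsFMatrix : (m : ℕ) → Matrix m → Set
IsFMatrix m A =
  InU012 m A ×
  Saturated A ⊤ ×
  (∀ (α : Subset m) → Nonempty α → α ≢ ⊤ → ¬ Saturated A α)

convex : ∀ {m} → ℚ → Matrix m → Matrix m → Matrix m
convex t B C i j = t * B i j + (1ℚ - t) * C i j

IsExtremePoint : (m : ℕ) → Matrix m → Set
IsExtremePoint m A =
  InU m A ×
  (∀ (B C : Matrix m) (t : ℚ) → InU m B → InU m C → 0ℚ < t → t < 1ℚ →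
     (∀ i j → A i j ≡ convex t B C i j) → ∀ i j → B i j ≡ C i j)

-- Two nonzero entries of an F-matrix in different symmetric positions exist because the
-- entries are at most 1 and add up to m ≥ 3. Moving a quarter of a unit of mass (placed
-- symmetrically) from one position to the other, or back, keeps the matrix in U_m: entries
-- stay nonnegative because nonzero entries are at least ½, the total over I_m is unchanged,
-- and every other nonempty block sum, being an unsaturated half-integer, lies at least ½
-- below |α| while the move changes it by at most ½. The matrix is the midpoint of the two
-- moved matrices.
module Submission where

open import Defs
open import Data.Nat as ℕ using (ℕ; zero; suc; _≥_; z≤n; s≤s)
import Data.Nat.Properties as ℕₚ
open import Data.Fin using (Fin; zero; suc)
open import Data.Fin.Properties using (any?) renaming (_≟_ to _≟ᶠ_)
open import Data.Fin.Subset using (Subset; _∈_; _∉_; ⊤; ∣_∣; Nonempty)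
open import Data.Fin.Subset.Properties using (_∈?_; ∈⊤; ∣⊤∣≡n; nonempty?)
open import Data.Vec.Properties using (≡-dec)
open import Data.Bool.Properties using () renaming (_≟_ to _≟ᵇ_)
import Data.Integer as ℤ
import Data.Integer.Solver as ℤ-Solver
open import Data.Rational using (ℚ; 0ℚ; 1ℚ; ½; _+_; _*_; _-_; -_; _≤_; _<_; _/_; *<*; toℚᵘ)
open import Data.Rational.Properties
import Data.Rational.Unnormalised as ℚᵘ
import Data.Rational.Unnormalised.Properties as ℚᵘ
open import Data.Rational.Solver using (module +-*-Solver)
open import Data.Product using (_×_; ∃; _,_; proj₁; proj₂)
open import Data.Sum using (_⊎_; inj₁; inj₂)
open import Data.Empty using (⊥; ⊥-elim)
open import Data.Unit using (tt)
open import Relation.Nullary using (¬_; yes; no; Dec; _×-dec_; _⊎-dec_; ¬?)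
open import Relation.Binary using (tri<; tri≈; tri>)
open import Relation.Binary.PropositionalEquality

fromℕ : ℕ → ℚ
fromℕ zero    = 0ℚ
fromℕ (suc n) = 1ℚ + fromℕ n

fromℕ-+ : ∀ a b → fromℕ (a ℕ.+ b) ≡ fromℕ a + fromℕ b
fromℕ-+ zero    b = sym (+-identityˡ (fromℕ b))
fromℕ-+ (suc a) b = trans (cong (1ℚ +_) (fromℕ-+ a b)) (sym (+-assoc 1ℚ (fromℕ a) (fromℕ b)))

0≤fromℕ : ∀ n → 0ℚ ≤ fromℕ n
0≤fromℕ zero    = ≤-refl
0≤fromℕ (suc n) = +-mono-≤ {0ℚ} {1ℚ} (≤ᵇ⇒≤ tt) (0≤fromℕ n)

fromℕ-mono-≤ : ∀ {a b} → a ℕ.≤ b → fromℕ a ≤ fromℕ b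
fromℕ-mono-≤ {b = b} z≤n = 0≤fromℕ b
fromℕ-mono-≤ (s≤s a≤b)   = +-monoʳ-≤ 1ℚ (fromℕ-mono-≤ a≤b)

fromℕ-mono-< : ∀ {a b} → a ℕ.< b → fromℕ a < fromℕ b
fromℕ-mono-< {b = suc b} (s≤s a≤b) = ≤-<-trans (fromℕ-mono-≤ a≤b)
  (subst (_< 1ℚ + fromℕ b) (+-identityˡ (fromℕ b)) (+-monoˡ-< (fromℕ b) (positive⁻¹ 1ℚ)))

fromℕ-cancel-< : ∀ {a b} → fromℕ a < fromℕ b → a ℕ.< b
fromℕ-cancel-< {a} {b} lt with a ℕ.<? b
... | yes a<b = a<b
... | no  a≮b = ⊥-elim (<-irrefl refl (<-≤-trans lt (fromℕ-mono-≤ (ℕₚ.≮⇒≥ a≮b))))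

suc≃1+ : ∀ n → ℚᵘ.mkℚᵘ (ℤ.+ suc n) 0 ℚᵘ.≃ ℚᵘ.1ℚᵘ ℚᵘ.+ ℚᵘ.mkℚᵘ (ℤ.+ n) 0
suc≃1+ n = ℚᵘ.*≡* (solve 2 (λ x o → (o :+ x) :* (o :* o) := (o :* o :+ x :* o) :* o) refl (ℤ.+ n) (ℤ.+ 1))
  where open ℤ-Solver.+-*-Solver

/1≡fromℕ : ∀ n → ℤ.+ n / 1 ≡ fromℕ n
/1≡fromℕ zero    = refl
/1≡fromℕ (suc n) = trans (toℚᵘ-injective (begin
    toℚᵘ (ℤ.+ suc n / 1)               ≈⟨ toℚᵘ-fromℚᵘ (ℚᵘ.mkℚᵘ (ℤ.+ suc n) 0) ⟩
    ℚᵘ.mkℚᵘ (ℤ.+ suc n) 0              ≈⟨ suc≃1+ n ⟩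
    ℚᵘ.1ℚᵘ ℚᵘ.+ ℚᵘ.mkℚᵘ (ℤ.+ n) 0      ≈⟨ ℚᵘ.+-congʳ ℚᵘ.1ℚᵘ (toℚᵘ-fromℚᵘ (ℚᵘ.mkℚᵘ (ℤ.+ n) 0)) ⟨
    toℚᵘ 1ℚ ℚᵘ.+ toℚᵘ (ℤ.+ n / 1)      ≈⟨ toℚᵘ-homo-+ 1ℚ (ℤ.+ n / 1) ⟨
    toℚᵘ (1ℚ + ℤ.+ n / 1)              ∎))
  (cong (1ℚ +_) (/1≡fromℕ n))
  where open ℚᵘ.≃-Reasoning

card≡fromℕ : ∀ {m} (α : Subset m) → card α ≡ fromℕ ∣ α ∣
card≡fromℕ α = /1≡fromℕ ∣ α ∣

open +-*-Solver

ΣFin-cong : ∀ n {f g : Fin n → ℚ} → (∀ i → f i ≡ g i) → ΣFin n f ≡ ΣFin n g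
ΣFin-cong zero    f≗g = refl
ΣFin-cong (suc n) f≗g = cong₂ _+_ (f≗g zero) (ΣFin-cong n (λ i → f≗g (suc i)))

ΣFin-mono-≤ : ∀ n {f g : Fin n → ℚ} → (∀ i → f i ≤ g i) → ΣFin n f ≤ ΣFin n g
ΣFin-mono-≤ zero    f≤g = ≤-refl
ΣFin-mono-≤ (suc n) f≤g = +-mono-≤ (f≤g zero) (ΣFin-mono-≤ n (λ i → f≤g (suc i)))

ΣFin-0 : ∀ n → ΣFin n (λ _ → 0ℚ) ≡ 0ℚ
ΣFin-0 zero    = refl
ΣFin-0 (suc n) = cong (0ℚ +_) (ΣFin-0 n)

ΣFin-+ : ∀ n (f g : Fin n → ℚ) → ΣFin n (λ i → f i + g i) ≡ ΣFin n f + ΣFin n g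
ΣFin-+ zero    f g = refl
ΣFin-+ (suc n) f g = trans (cong (f zero + g zero +_) (ΣFin-+ n (λ i → f (suc i)) (λ i → g (suc i))))
  (solve 4 (λ a b x y → (a :+ b) :+ (x :+ y) := (a :+ x) :+ (b :+ y)) refl
    (f zero) (g zero) (ΣFin n (λ i → f (suc i))) (ΣFin n (λ i → g (suc i))))

ΣFin-neg : ∀ n (f : Fin n → ℚ) → ΣFin n (λ i → - f i) ≡ - ΣFin n f
ΣFin-neg zero    f = refl
ΣFin-neg (suc n) f = trans (cong (- f zero +_) (ΣFin-neg n (λ i → f (suc i))))
  (sym (neg-distrib-+ (f zero) (ΣFin n (λ i → f (suc i)))))

ΣFin-*ˡ : ∀ n c (f : Fin n → ℚ) → ΣFin n (λ i → c * f i) ≡ c * ΣFin n f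
ΣFin-*ˡ zero    c f = sym (*-zeroʳ c)
ΣFin-*ˡ (suc n) c f = trans (cong (c * f zero +_) (ΣFin-*ˡ n c (λ i → f (suc i))))
  (sym (*-distribˡ-+ c (f zero) (ΣFin n (λ i → f (suc i)))))

ΣFin-- : ∀ n (f g : Fin n → ℚ) → ΣFin n (λ i → f i - g i) ≡ ΣFin n f - ΣFin n g
ΣFin-- n f g = trans (ΣFin-+ n f (λ i → - g i)) (cong (ΣFin n f +_) (ΣFin-neg n g))

entrySum : ∀ {m} → Matrix m → ℚ
entrySum {m} A = ΣFin m (λ i → ΣFin m (A i))

ΣFin-closed : ∀ (P : ℚ → Set) → P 0ℚ → (∀ {x y} → P x → P y → P (x + y)) →
              ∀ n {f : Fin n → ℚ} → (∀ i → P (f i)) → P (ΣFin n f)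
ΣFin-closed P P0 P+ zero    Pf = P0
ΣFin-closed P P0 P+ (suc n) Pf = P+ (Pf zero) (ΣFin-closed P P0 P+ n (λ i → Pf (suc i)))

module _ {m} (α : Subset m) where

  restrict-∈ : ∀ (f : Matrix m) {i j} → i ∈ α → j ∈ α → restrict α f i j ≡ f i j
  restrict-∈ f {i} {j} i∈α j∈α with i ∈? α | j ∈? α
  ... | yes _   | yes _   = refl
  ... | no i∉α  | _       = ⊥-elim (i∉α i∈α)
  ... | yes _   | no j∉α  = ⊥-elim (j∉α j∈α)

  restrict-∉ : ∀ (f : Matrix m) {i} j → i ∉ α → restrict α f i j ≡ 0ℚ
  restrict-∉ f {i} j i∉α with i ∈? α | j ∈? α
  ... | yes i∈α | _     = ⊥-elim (i∉α i∈α)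
  ... | no _    | yes _ = refl
  ... | no _    | no _  = refl

  restrict-elim : ∀ (P : ℚ → Set) (f : Matrix m) i j → P 0ℚ → P (f i j) → P (restrict α f i j)
  restrict-elim P f i j P0 Pf with i ∈? α | j ∈? α
  ... | yes _ | yes _ = Pf
  ... | yes _ | no _  = P0
  ... | no _  | _     = P0

  restrict-map₂ : ∀ (F : ℚ → ℚ → ℚ) → F 0ℚ 0ℚ ≡ 0ℚ → ∀ (f g : Matrix m) i j →
                  restrict α (λ i j → F (f i j) (g i j)) i j ≡ F (restrict α f i j) (restrict α g i j)
  restrict-map₂ F F00 f g i j with i ∈? α | j ∈? α
  ... | yes _ | yes _ = refl
  ... | yes _ | no _  = sym F00
  ... | no _  | _     = sym F00

  blockSum-map₂ : ∀ (F : ℚ → ℚ → ℚ) → F 0ℚ 0ℚ ≡ 0ℚ → (∀ n f g → ΣFin n (λ i → F (f i) (g i)) ≡ F (ΣFin n f) (ΣFin n g)) →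
                  ∀ (f g : Matrix m) → blockSum (λ i j → F (f i j) (g i j)) α ≡ F (blockSum f α) (blockSum g α)
  blockSum-map₂ F F00 ΣF f g = begin
    ΣFin m (λ i → ΣFin m (λ j → restrict α (λ i j → F (f i j) (g i j)) i j))
      ≡⟨ ΣFin-cong m (λ i → ΣFin-cong m (restrict-map₂ F F00 f g i)) ⟩
    ΣFin m (λ i → ΣFin m (λ j → F (restrict α f i j) (restrict α g i j)))
      ≡⟨ ΣFin-cong m (λ i → ΣF m (restrict α f i) (restrict α g i)) ⟩
    ΣFin m (λ i → F (ΣFin m (restrict α f i)) (ΣFin m (restrict α g i)))
      ≡⟨ ΣF m _ _ ⟩
    F (blockSum f α) (blockSum g α) ∎
    where open ≡-Reasoning

  blockSum-+ : ∀ (f g : Matrix m) → blockSum (λ i j → f i j + g i j) α ≡ blockSum f α + blockSum g α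
  blockSum-+ = blockSum-map₂ _+_ refl ΣFin-+

  blockSum-- : ∀ (f g : Matrix m) → blockSum (λ i j → f i j - g i j) α ≡ blockSum f α - blockSum g α
  blockSum-- = blockSum-map₂ _-_ refl ΣFin--

  blockSum-*ˡ : ∀ c (f : Matrix m) → blockSum (λ i j → c * f i j) α ≡ c * blockSum f α
  blockSum-*ˡ c f = blockSum-map₂ (λ _ y → c * y) (*-zeroʳ c) (λ n _ g → ΣFin-*ˡ n c g) f f

  blockSum-closed : ∀ (P : ℚ → Set) → P 0ℚ → (∀ {x y} → P x → P y → P (x + y)) →
                    ∀ (f : Matrix m) → (∀ i j → P (f i j)) → P (blockSum f α)
  blockSum-closed P P0 P+ f Pf =
    ΣFin-closed P P0 P+ m (λ i → ΣFin-closed P P0 P+ m (λ j → restrict-elim P f i j P0 (Pf i j)))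

  blockSum-nonNeg : ∀ (f : Matrix m) → (∀ i j → 0ℚ ≤ f i j) → 0ℚ ≤ blockSum f α
  blockSum-nonNeg = blockSum-closed (0ℚ ≤_) ≤-refl (+-mono-≤ {0ℚ} {_} {0ℚ})

  blockSum≤entrySum : ∀ (f : Matrix m) → (∀ i j → 0ℚ ≤ f i j) → blockSum f α ≤ entrySum f
  blockSum≤entrySum f f≥0 =
    ΣFin-mono-≤ m (λ i → ΣFin-mono-≤ m (λ j → restrict-elim (_≤ f i j) f i j (f≥0 i j) ≤-refl))

  blockSum-empty : ∀ (f : Matrix m) → (∀ i → i ∉ α) → blockSum f α ≡ 0ℚ
  blockSum-empty f α-empty = begin
    ΣFin m (λ i → ΣFin m (λ j → restrict α f i j)) ≡⟨ ΣFin-cong m (λ i → ΣFin-cong m (λ j → restrict-∉ f j (α-empty i))) ⟩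
    ΣFin m (λ i → ΣFin m (λ _ → 0ℚ))               ≡⟨ ΣFin-cong m (λ _ → ΣFin-0 m) ⟩
    ΣFin m (λ _ → 0ℚ)                              ≡⟨ ΣFin-0 m ⟩
    0ℚ                                             ∎
    where open ≡-Reasoning

blockSum-⊤ : ∀ {m} (f : Matrix m) → blockSum f ⊤ ≡ entrySum f
blockSum-⊤ {m} f = ΣFin-cong m (λ i → ΣFin-cong m (λ j → restrict-∈ ⊤ f ∈⊤ ∈⊤))

Halfℕ : ℚ → Set
Halfℕ x = ∃ λ k → x + x ≡ fromℕ k

Halfℕ-+ : ∀ {x y} → Halfℕ x → Halfℕ y → Halfℕ (x + y)
Halfℕ-+ {x} {y} (a , 2x≡a) (b , 2y≡b) = a ℕ.+ b , (begin
  (x + y) + (x + y)  ≡⟨ solve 2 (λ x y → (x :+ y) :+ (x :+ y) := (x :+ x) :+ (y :+ y)) refl x y ⟩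
  (x + x) + (y + y)  ≡⟨ cong₂ _+_ 2x≡a 2y≡b ⟩
  fromℕ a + fromℕ b  ≡⟨ fromℕ-+ a b ⟨
  fromℕ (a ℕ.+ b)    ∎)
  where open ≡-Reasoning

Halfℕ-blockSum : ∀ {m} (f : Matrix m) → (∀ i j → Halfℕ (f i j)) → ∀ α → Halfℕ (blockSum f α)
Halfℕ-blockSum f f-half α = blockSum-closed α Halfℕ (0 , refl) (λ {x} {y} → Halfℕ-+ {x} {y}) f f-half

Halfℕ-<⇒+½≤ : ∀ {x} n → Halfℕ x → x < fromℕ n → x + ½ ≤ fromℕ n
Halfℕ-<⇒+½≤ {x} n (k , 2x≡k) x<n = *-cancelʳ-≤-pos (fromℕ 2) (begin
  (x + ½) * fromℕ 2     ≡⟨ solve 1 (λ x → (x :+ con ½) :* con (fromℕ 2) := con 1ℚ :+ (x :+ x)) refl x ⟩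
  1ℚ + (x + x)          ≡⟨ cong (1ℚ +_) 2x≡k ⟩
  fromℕ (suc k)         ≤⟨ fromℕ-mono-≤ k<2n ⟩
  fromℕ (n ℕ.+ n)       ≡⟨ fromℕ-+ n n ⟩
  fromℕ n + fromℕ n     ≡⟨ solve 1 (λ y → y :+ y := y :* con (fromℕ 2)) refl (fromℕ n) ⟩
  fromℕ n * fromℕ 2     ∎)
  where
  open ≤-Reasoning
  k<2n : k ℕ.< n ℕ.+ n
  k<2n = fromℕ-cancel-< (subst₂ _<_ 2x≡k (sym (fromℕ-+ n n)) (+-mono-< x<n x<n))

ZeroHalfOne : ℚ → Set
ZeroHalfOne x = (x ≡ 0ℚ) ⊎ ((x ≡ ½) ⊎ (x ≡ 1ℚ))

ZeroHalfOne⇒Halfℕ : ∀ {x} → ZeroHalfOne x → Halfℕ x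
ZeroHalfOne⇒Halfℕ (inj₁ refl)        = 0 , refl
ZeroHalfOne⇒Halfℕ (inj₂ (inj₁ refl)) = 1 , refl
ZeroHalfOne⇒Halfℕ (inj₂ (inj₂ refl)) = 2 , refl

ZeroHalfOne⇒≤1 : ∀ {x} → ZeroHalfOne x → x ≤ 1ℚ
ZeroHalfOne⇒≤1 (inj₁ refl)        = ≤ᵇ⇒≤ tt
ZeroHalfOne⇒≤1 (inj₂ (inj₁ refl)) = ≤ᵇ⇒≤ tt
ZeroHalfOne⇒≤1 (inj₂ (inj₂ refl)) = ≤ᵇ⇒≤ tt

ZeroHalfOne-≢0⇒½≤ : ∀ {x} → ZeroHalfOne x → x ≢ 0ℚ → ½ ≤ x
ZeroHalfOne-≢0⇒½≤ (inj₁ x≡0)        x≢0 = ⊥-elim (x≢0 x≡0)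
ZeroHalfOne-≢0⇒½≤ (inj₂ (inj₁ refl)) _   = ≤-refl
ZeroHalfOne-≢0⇒½≤ (inj₂ (inj₂ refl)) _   = ≤ᵇ⇒≤ tt

δ : ∀ {n} → Fin n → Fin n → ℚ
δ zero    zero    = 1ℚ
δ zero    (suc _) = 0ℚ
δ (suc _) zero    = 0ℚ
δ (suc p) (suc i) = δ p i

δ-refl : ∀ {n} (p : Fin n) → δ p p ≡ 1ℚ
δ-refl zero    = refl
δ-refl (suc p) = δ-refl p

δ-≢ : ∀ {n} {p i : Fin n} → p ≢ i → δ p i ≡ 0ℚ
δ-≢ {p = zero}  {zero}  p≢i = ⊥-elim (p≢i refl)
δ-≢ {p = zero}  {suc i} p≢i = refl
δ-≢ {p = suc p} {zero}  p≢i = refl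
δ-≢ {p = suc p} {suc i} p≢i = δ-≢ (λ p≡i → p≢i (cong suc p≡i))

ΣFin-δ : ∀ n (p : Fin n) → ΣFin n (δ p) ≡ 1ℚ
ΣFin-δ (suc n) zero    = cong (1ℚ +_) (ΣFin-0 n)
ΣFin-δ (suc n) (suc p) = cong (0ℚ +_) (ΣFin-δ n p)

unit : ∀ {n} → Fin n → Fin n → Matrix n
unit p q i j = δ p i * δ q j

unit-off : ∀ {n} {p q i j : Fin n} → ¬ (i ≡ p × j ≡ q) → unit p q i j ≡ 0ℚ
unit-off {p = p} {q} {i} {j} ¬at with p ≟ᶠ i | q ≟ᶠ j
... | yes refl | yes refl = ⊥-elim (¬at (refl , refl))
... | no p≢i   | _        = trans (cong (_* δ q j) (δ-≢ p≢i)) (*-zeroˡ (δ q j))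
... | yes _    | no q≢j   = trans (cong (δ p i *_) (δ-≢ q≢j)) (*-zeroʳ (δ p i))

unit-bounds : ∀ {n} (p q i j : Fin n) → 0ℚ ≤ unit p q i j × unit p q i j ≤ 1ℚ
unit-bounds p q i j with (i ≟ᶠ p) ×-dec (j ≟ᶠ q)
... | yes (refl , refl) = subst (λ x → 0ℚ ≤ x × x ≤ 1ℚ) (sym (cong₂ _*_ (δ-refl p) (δ-refl q))) (≤ᵇ⇒≤ tt , ≤-refl)
... | no ¬at            = subst (λ x → 0ℚ ≤ x × x ≤ 1ℚ) (sym (unit-off ¬at)) (≤-refl , ≤ᵇ⇒≤ tt)

entrySum-unit : ∀ {n} (p q : Fin n) → entrySum (unit p q) ≡ 1ℚ
entrySum-unit {n} p q = begin
  ΣFin n (λ i → ΣFin n (λ j → δ p i * δ q j)) ≡⟨ ΣFin-cong n (λ i → ΣFin-*ˡ n (δ p i) (δ q)) ⟩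
  ΣFin n (λ i → δ p i * ΣFin n (δ q))         ≡⟨ ΣFin-cong n (λ i → cong (δ p i *_) (ΣFin-δ n q)) ⟩
  ΣFin n (λ i → δ p i * 1ℚ)                   ≡⟨ ΣFin-cong n (λ i → *-identityʳ (δ p i)) ⟩
  ΣFin n (δ p)                                ≡⟨ ΣFin-δ n p ⟩
  1ℚ                                          ∎
  where open ≡-Reasoning

-- symUnit p p has the entry 2 at (p , p), so the total mass is 2 in every case.
symUnit : ∀ {n} → Fin n → Fin n → Matrix n
symUnit p q i j = unit p q i j + unit q p i j

OnPair : ∀ {n} → Fin n → Fin n → Fin n → Fin n → Set
OnPair p q i j = (i ≡ p × j ≡ q) ⊎ (i ≡ q × j ≡ p)

onPair? : ∀ {n} (p q i j : Fin n) → Dec (OnPair p q i j)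
onPair? p q i j = ((i ≟ᶠ p) ×-dec (j ≟ᶠ q)) ⊎-dec ((i ≟ᶠ q) ×-dec (j ≟ᶠ p))

symUnit-sym : ∀ {n} (p q i j : Fin n) → symUnit p q i j ≡ symUnit p q j i
symUnit-sym p q i j =
  solve 4 (λ a b c d → a :* b :+ c :* d := d :* c :+ b :* a) refl (δ p i) (δ q j) (δ q i) (δ p j)

symUnit-off : ∀ {n} {p q i j : Fin n} → ¬ OnPair p q i j → symUnit p q i j ≡ 0ℚ
symUnit-off ¬on = cong₂ _+_ (unit-off (λ at → ¬on (inj₁ at))) (unit-off (λ at → ¬on (inj₂ at)))

1≤symUnit-on : ∀ {n} {p q i j : Fin n} → OnPair p q i j → 1ℚ ≤ symUnit p q i j
1≤symUnit-on {p = p} {q} (inj₁ (refl , refl)) =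
  subst (λ x → 1ℚ ≤ x + unit q p p q) (sym (cong₂ _*_ (δ-refl p) (δ-refl q)))
    (+-monoʳ-≤ 1ℚ (proj₁ (unit-bounds q p p q)))
1≤symUnit-on {p = p} {q} (inj₂ (refl , refl)) =
  subst (λ x → 1ℚ ≤ unit p q q p + x) (sym (cong₂ _*_ (δ-refl q) (δ-refl p)))
    (subst (1ℚ ≤_) (+-comm 1ℚ (unit p q q p)) (+-monoʳ-≤ 1ℚ (proj₁ (unit-bounds p q q p))))

symUnit-bounds : ∀ {n} (p q i j : Fin n) → 0ℚ ≤ symUnit p q i j × symUnit p q i j ≤ fromℕ 2
symUnit-bounds p q i j with unit-bounds p q i j | unit-bounds q p i j
... | 0≤pq , pq≤1 | 0≤qp , qp≤1 = +-mono-≤ 0≤pq 0≤qp , +-mono-≤ pq≤1 qp≤1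

entrySum-symUnit : ∀ {n} (p q : Fin n) → entrySum (symUnit p q) ≡ fromℕ 2
entrySum-symUnit {n} p q = begin
  ΣFin n (λ i → ΣFin n (λ j → unit p q i j + unit q p i j))
    ≡⟨ ΣFin-cong n (λ i → ΣFin-+ n (unit p q i) (unit q p i)) ⟩
  ΣFin n (λ i → ΣFin n (unit p q i) + ΣFin n (unit q p i))
    ≡⟨ ΣFin-+ n _ _ ⟩
  entrySum (unit p q) + entrySum (unit q p)
    ≡⟨ cong₂ _+_ (entrySum-unit p q) (entrySum-unit q p) ⟩
  fromℕ 2 ∎
  where open ≡-Reasoning

blockSum-symUnit-⊤ : ∀ {n} (p q : Fin n) → blockSum (symUnit p q) ⊤ ≡ fromℕ 2
blockSum-symUnit-⊤ p q = trans (blockSum-⊤ (symUnit p q)) (entrySum-symUnit p q)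

-- If all nonzero entries sat at {r , s}, then A ≤ symUnit r s entrywise and entrySum A ≤ 2.
nonzero-offPair : ∀ {m} (A : Matrix m) → (∀ i j → A i j ≤ 1ℚ) → fromℕ 2 < entrySum A →
                  ∀ r s → ∃ λ p → ∃ λ q → A p q ≢ 0ℚ × ¬ OnPair r s p q
nonzero-offPair {m} A A≤1 2<ΣA r s
  with any? (λ p → any? (λ q → ¬? (A p q ≟ 0ℚ) ×-dec ¬? (onPair? r s p q)))
... | yes found = found
... | no  none  = ⊥-elim (<-irrefl refl (<-≤-trans 2<ΣA ΣA≤2))
  where
  A≤symUnit : ∀ i j → A i j ≤ symUnit r s i j
  A≤symUnit i j with A i j ≟ 0ℚ | onPair? r s i j
  ... | yes Aij≡0 | _     = subst (_≤ symUnit r s i j) (sym Aij≡0) (proj₁ (symUnit-bounds r s i j))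
  ... | no  _     | yes on = ≤-trans (A≤1 i j) (1≤symUnit-on on)
  ... | no  Aij≢0 | no ¬on = ⊥-elim (none (i , j , Aij≢0 , ¬on))

  ΣA≤2 : entrySum A ≤ fromℕ 2
  ΣA≤2 = subst (entrySum A ≤_) (entrySum-symUnit r s) (ΣFin-mono-≤ m (λ i → ΣFin-mono-≤ m (A≤symUnit i)))

¼ : ℚ
¼ = ℤ.+ 1 / 4

transfer : ∀ {m} → Matrix m → (p q r s : Fin m) → Matrix m
transfer A p q r s i j = A i j + ¼ * (symUnit r s i j - symUnit p q i j)

transfer-midpoint : ∀ {m} (A : Matrix m) (p q r s : Fin m) i j →
                    A i j ≡ convex ½ (transfer A p q r s) (transfer A r s p q) i j
transfer-midpoint A p q r s i j =
  solve 3 (λ a x y → a := con ½ :* (a :+ con ¼ :* (x :- y)) :+ (con 1ℚ :- con ½) :* (a :+ con ¼ :* (y :- x)))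
    refl (A i j) (symUnit r s i j) (symUnit p q i j)

transfer-differs : ∀ {m} (A : Matrix m) {p q r s : Fin m} → ¬ OnPair p q r s →
                   transfer A p q r s r s ≢ transfer A r s p q r s
transfer-differs A {p} {q} {r} {s} ¬on B≡C = <-irrefl refl (<-≤-trans (positive⁻¹ 1ℚ) (begin
  1ℚ                                          ≤⟨ 1≤symUnit-on {p = r} {s} (inj₁ (refl , refl)) ⟩
  x                                           ≡⟨ solve 3 (λ a x y → x := y :+ con (fromℕ 2) :* ((a :+ con ¼ :* (x :- y)) :- (a :+ con ¼ :* (y :- x)))) refl a x y ⟩
  y + fromℕ 2 * (B - C)                       ≡⟨ cong (λ b → y + fromℕ 2 * (b - C)) B≡C ⟩
  y + fromℕ 2 * (C - C)                       ≡⟨ solve 2 (λ y c → y :+ con (fromℕ 2) :* (c :- c) := y) refl y C ⟩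
  y                                           ≡⟨ symUnit-off ¬on ⟩
  0ℚ                                          ∎))
  where
  open ≤-Reasoning
  a x y B C : ℚ
  a = A r s
  x = symUnit r s r s
  y = symUnit p q r s
  B = transfer A p q r s r s
  C = transfer A r s p q r s

≤∧≢⇒< : ∀ {x y : ℚ} → x ≤ y → x ≢ y → x < y
≤∧≢⇒< {x} {y} x≤y x≢y with <-cmp x y
... | tri< x<y _ _ = x<y
... | tri≈ _ x≡y _ = ⊥-elim (x≢y x≡y)
... | tri> _ _ x>y = ⊥-elim (<-irrefl refl (<-≤-trans x>y x≤y))

0≤a+¼[x-y] : ∀ a x y → ¼ * y ≤ a → 0ℚ ≤ x → 0ℚ ≤ a + ¼ * (x - y)
0≤a+¼[x-y] a x y ¼y≤a 0≤x = subst (0ℚ ≤_)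
  (solve 3 (λ a x y → (a :- con ¼ :* y) :+ con ¼ :* x := a :+ con ¼ :* (x :- y)) refl a x y)
  (+-mono-≤ {0ℚ} {_} {0ℚ} (subst (_≤ a - ¼ * y) (+-inverseʳ (¼ * y)) (+-monoˡ-≤ (- (¼ * y)) ¼y≤a))
                          (*-monoˡ-≤-nonNeg ¼ 0≤x))

¼[x-y]≤½ : ∀ {x y} → x ≤ fromℕ 2 → 0ℚ ≤ y → ¼ * (x - y) ≤ ½
¼[x-y]≤½ x≤2 0≤y = *-monoˡ-≤-nonNeg ¼ (+-mono-≤ x≤2 (neg-antimono-≤ 0≤y))

module _ {m} {A : Matrix m}
         (A-sym : ∀ i j → A i j ≡ A j i) (A≥0 : ∀ i j → 0ℚ ≤ A i j)
         (A-bound : ∀ α → blockSum A α ≤ card α) (A∈0½1 : ∀ i j → ZeroHalfOne (A i j))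
         (unsaturated : ∀ α → Nonempty α → α ≢ ⊤ → ¬ Saturated A α)
         {p q : Fin m} (Apq≢0 : A p q ≢ 0ℚ) (r s : Fin m) where

  ¼symUnit≤A : ∀ i j → ¼ * symUnit p q i j ≤ A i j
  ¼symUnit≤A i j with onPair? p q i j
  ... | yes (inj₁ (refl , refl)) = ≤-trans (*-monoˡ-≤-nonNeg ¼ (proj₂ (symUnit-bounds p q p q)))
                                           (ZeroHalfOne-≢0⇒½≤ (A∈0½1 p q) Apq≢0)
  ... | yes (inj₂ (refl , refl)) = ≤-trans (*-monoˡ-≤-nonNeg ¼ (proj₂ (symUnit-bounds p q q p)))
                                           (subst (½ ≤_) (A-sym p q) (ZeroHalfOne-≢0⇒½≤ (A∈0½1 p q) Apq≢0))
  ... | no ¬on                   = subst (λ e → ¼ * e ≤ A i j) (sym (symUnit-off ¬on)) (A≥0 i j)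

  blockSum-transfer : ∀ α → blockSum (transfer A p q r s) α ≡
                      blockSum A α + ¼ * (blockSum (symUnit r s) α - blockSum (symUnit p q) α)
  blockSum-transfer α = trans (blockSum-+ α A _)
    (cong (blockSum A α +_) (trans (blockSum-*ˡ α ¼ _) (cong (¼ *_) (blockSum-- α (symUnit r s) (symUnit p q)))))

  transfer-bound : ∀ α → blockSum (transfer A p q r s) α ≤ card α
  transfer-bound α with ≡-dec _≟ᵇ_ α ⊤
  ... | yes α≡⊤ = subst (λ β → blockSum (transfer A p q r s) β ≤ card β) (sym α≡⊤) (begin
    blockSum (transfer A p q r s) ⊤
      ≡⟨ blockSum-transfer ⊤ ⟩
    blockSum A ⊤ + ¼ * (blockSum (symUnit r s) ⊤ - blockSum (symUnit p q) ⊤)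
      ≡⟨ cong₂ (λ x y → blockSum A ⊤ + ¼ * (x - y)) (blockSum-symUnit-⊤ r s) (blockSum-symUnit-⊤ p q) ⟩
    blockSum A ⊤ + ¼ * (fromℕ 2 - fromℕ 2)
      ≡⟨ cong (λ z → blockSum A ⊤ + ¼ * z) (+-inverseʳ (fromℕ 2)) ⟩
    blockSum A ⊤ + ¼ * 0ℚ
      ≡⟨ cong (blockSum A ⊤ +_) (*-zeroʳ ¼) ⟩
    blockSum A ⊤ + 0ℚ
      ≡⟨ +-identityʳ (blockSum A ⊤) ⟩
    blockSum A ⊤
      ≤⟨ A-bound ⊤ ⟩
    card (⊤ {m}) ∎)
    where open ≤-Reasoning
  ... | no α≢⊤ with nonempty? α
  ...   | no α-empty = subst₂ _≤_ (sym (blockSum-empty α _ (λ i i∈α → α-empty (i , i∈α))))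
                                  (sym (card≡fromℕ α)) (0≤fromℕ ∣ α ∣)
  ...   | yes α≠∅    = begin
    blockSum (transfer A p q r s) α
      ≡⟨ blockSum-transfer α ⟩
    blockSum A α + ¼ * (blockSum (symUnit r s) α - blockSum (symUnit p q) α)
      ≤⟨ +-monoʳ-≤ (blockSum A α) (¼[x-y]≤½ ΣE-rs≤2 ΣE-pq≥0) ⟩
    blockSum A α + ½
      ≤⟨ Halfℕ-<⇒+½≤ ∣ α ∣ (Halfℕ-blockSum A (λ i j → ZeroHalfOne⇒Halfℕ (A∈0½1 i j)) α) A<|α| ⟩
    fromℕ ∣ α ∣
      ≡⟨ card≡fromℕ α ⟨
    card α ∎
    where
    open ≤-Reasoning
    ΣE-rs≤2 : blockSum (symUnit r s) α ≤ fromℕ 2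
    ΣE-rs≤2 = subst (blockSum (symUnit r s) α ≤_) (entrySum-symUnit r s)
                (blockSum≤entrySum α (symUnit r s) (λ i j → proj₁ (symUnit-bounds r s i j)))
    ΣE-pq≥0 : 0ℚ ≤ blockSum (symUnit p q) α
    ΣE-pq≥0 = blockSum-nonNeg α (symUnit p q) (λ i j → proj₁ (symUnit-bounds p q i j))
    A<|α| : blockSum A α < fromℕ ∣ α ∣
    A<|α| = subst (blockSum A α <_) (card≡fromℕ α)
              (≤∧≢⇒< (A-bound α) (λ sat → unsaturated α α≠∅ α≢⊤ (α≠∅ , sat)))

  transfer-∈U : InU m (transfer A p q r s)
  transfer-∈U =
    (λ i j → cong₂ (λ a d → a + ¼ * d) (A-sym i j) (cong₂ _-_ (symUnit-sym r s i j) (symUnit-sym p q i j))) ,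
    (λ i j → 0≤a+¼[x-y] (A i j) _ _ (¼symUnit≤A i j) (proj₁ (symUnit-bounds r s i j))) ,
    transfer-bound

two-nonzero-offPair : ∀ {m} (A : Matrix (suc m)) → (∀ i j → A i j ≤ 1ℚ) → fromℕ 2 < entrySum A →
                      ∃ λ p → ∃ λ q → ∃ λ r → ∃ λ s → A p q ≢ 0ℚ × A r s ≢ 0ℚ × ¬ OnPair p q r s
two-nonzero-offPair A A≤1 2<ΣA with nonzero-offPair A A≤1 2<ΣA zero zero
... | p , q , Apq≢0 , _ with nonzero-offPair A A≤1 2<ΣA p q
...   | r , s , Ars≢0 , ¬on = p , q , r , s , Apq≢0 , Ars≢0 , ¬on

⊤-saturated⇒entrySum≡m : ∀ {m} (A : Matrix m) → blockSum A ⊤ ≡ card (⊤ {m}) → entrySum A ≡ fromℕ m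
⊤-saturated⇒entrySum≡m {m} A ⊤-saturated = begin
  entrySum A        ≡⟨ blockSum-⊤ A ⟨
  blockSum A ⊤      ≡⟨ ⊤-saturated ⟩
  card (⊤ {m})      ≡⟨ card≡fromℕ (⊤ {m}) ⟩
  fromℕ ∣ ⊤ {m} ∣   ≡⟨ cong fromℕ (∣⊤∣≡n m) ⟩
  fromℕ m           ∎
  where open ≡-Reasoning

proposition3p8 : (m : ℕ) → m ≥ 3 → (A : Matrix m) → IsFMatrix m A → ¬ IsExtremePoint m A
proposition3p8 zero ()
proposition3p8 m@(suc _) 3≤m A (((A-sym , A≥0 , A-bound) , _ , A∈0½1) , (_ , ⊤-saturated) , unsaturated) (_ , extreme) =
  midpoint-of-transfers (two-nonzero-offPair A (λ i j → ZeroHalfOne⇒≤1 (A∈0½1 i j)) 2<ΣA)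
  where
  2<ΣA : fromℕ 2 < entrySum A
  2<ΣA = subst (fromℕ 2 <_) (sym (⊤-saturated⇒entrySum≡m A ⊤-saturated)) (fromℕ-mono-< 3≤m)

  ∈U : ∀ {p q} → A p q ≢ 0ℚ → ∀ r s → InU m (transfer A p q r s)
  ∈U = transfer-∈U A-sym A≥0 A-bound A∈0½1 unsaturated

  midpoint-of-transfers : (∃ λ p → ∃ λ q → ∃ λ r → ∃ λ s → A p q ≢ 0ℚ × A r s ≢ 0ℚ × ¬ OnPair p q r s) → ⊥
  midpoint-of-transfers (p , q , r , s , Apq≢0 , Ars≢0 , ¬on) =
    transfer-differs A ¬on (extreme (transfer A p q r s) (transfer A r s p q) ½
      (∈U Apq≢0 r s) (∈U Ars≢0 p q) (positive⁻¹ ½) (*<* (ℤ.+<+ (s≤s (s≤s z≤n))))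
      (transfer-midpoint A p q r s) r s)
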